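{- Let $n,r,s$ be positive integers with $n>r$. Then $(n^r,r^s)$ is a $\mathcal P$-position of LCTR, so $\mathrm{SG}(n^r,r^s)=0$.
   Context: $(n^r,r^s)$ is the partition with $r$ parts equal to $n$ followed by $s$ parts equal to $r$. LCTR: from nonempty $\lambda=(\lambda_1,\dots,\lambda_k)$ one may move to $T(\lambda)=(\lambda_2,\dots,\lambda_k)$ or $L(\lambda)=(\lambda_1-1,\dots,\lambda_k-1)$ (nonpositive entries omitted); $()$ has no moves; normal play. A $\mathcal P$-position is one from which the previous player has a winning strategy. $\mathrm{SG}(())=0$, $\mathrm{SG}(\lambda)=\mathrm{mex}\{\mathrm{SG}(L(\lambda)),\mathrm{SG}(T(\lambda))\}$ otherwise. -}

module Defs where

open import Data.Nat using (ℕ; zero; suc; _∸_; _≟_)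
open import Data.Nat.Properties using ()
open import Data.List using (List; []; _∷_; map; filter; replicate; _++_)
open import Data.Nat.ListAction using (sum)
open import Data.Product using (_×_; _,_)
open import Relation.Nullary using (¬_; yes; no)
open import Relation.Nullary.Decidable using (¬?)
open import Relation.Binary.PropositionalEquality using (_≡_)

-- A partition is a (weakly decreasing) list of positive naturals.
Partition : Set
Partition = List ℕ

T : Partition → Partition
T []       = []
T (_ ∷ xs) = xs

L : Partition → Partition
L xs = filter (λ x → ¬? (x ≟ 0)) (map (λ x → x ∸ 1) xs)

nrrs : ℕ → ℕ → ℕ → Partition
nrrs n r s = replicate r n ++ replicate s r

mex2 : ℕ → ℕ → ℕ
mex2 a b with a ≟ 0 | b ≟ 0
... | no _  | no _  = 0
... | _     | _     with a ≟ 1 | b ≟ 1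
...   | no _ | no _ = 1
...   | _    | _    = 2

-- Sprague–Grundy value with fuel; every move from a nonempty partition of
-- positive parts strictly decreases the sum, so fuel  suc (sum λ)  suffices.
SG-fuel : ℕ → Partition → ℕ
SG-fuel zero    _  = 0
SG-fuel (suc f) [] = 0
SG-fuel (suc f) (x ∷ xs) = mex2 (SG-fuel f (L (x ∷ xs))) (SG-fuel f (T (x ∷ xs)))

SG : Partition → ℕ
SG λ' = SG-fuel (suc (sum λ')) λ'

mutual
  data IsP : Partition → Set where
    p-empty : IsP []
    p-move  : ∀ x xs → IsN (L (x ∷ xs)) → IsN (T (x ∷ xs)) → IsP (x ∷ xs)

  data IsN : Partition → Set where
    n-L : ∀ x xs → IsP (L (x ∷ xs)) → IsN (x ∷ xs)
    n-T : ∀ x xs → IsP (T (x ∷ xs)) → IsN (x ∷ xs)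

-- When the largest part is at least 2 and there is a second part, the moves
-- L∘T and T∘L reach the same position; if that position is a P-position, both
-- moves lead to N-positions and the original position is a P-position. For
-- (n^r, r^s) with n > r this common position is ((n-1)^(r-1), (r-1)^s), of the
-- same shape (or empty when r = 1), so induction on r settles the game. The
-- Sprague–Grundy value vanishes because the fuelled SG computes the P/N
-- classification on partitions with positive parts: each move lowers the sum
-- of the parts, so the fuel suc (sum λ) never runs out.
module Submission where

open import Defs
open import Data.Nat using (ℕ; zero; suc; _+_; _∸_; _<_; _>_; _≤_; z≤n; s≤s; _≟_)
open import Data.Nat.Properties
  using (≤-refl; ≤-trans; <-≤-trans; n≤1+n; +-mono-≤; +-monoʳ-≤; m≤n+m; 1+n≢0; m≤n⇒∃[o]m+o≡n)
open import Data.Nat.ListAction using (sum)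
open import Data.List using ([]; _∷_; map; filter; replicate; _++_)
open import Data.List.Properties using (map-++; filter-++)
open import Data.List.Relation.Unary.All using (All; _∷_)
open import Data.List.Relation.Unary.All.Properties using (all-filter; ++⁺; replicate⁺)
open import Data.Product using (_×_; _,_; proj₁; proj₂)
open import Data.Empty using (⊥-elim)
open import Relation.Nullary using (yes; no)
open import Relation.Nullary.Decidable using (¬?)
open import Relation.Binary.PropositionalEquality
  using (_≡_; _≢_; refl; cong; cong₂; subst; sym; trans)

L-++ : ∀ xs ys → L (xs ++ ys) ≡ L xs ++ L ys
L-++ xs ys = trans (cong (filter (λ x → ¬? (x ≟ 0))) (map-++ (_∸ 1) xs ys))
                   (filter-++ (λ x → ¬? (x ≟ 0)) (map (_∸ 1) xs) (map (_∸ 1) ys))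

L-replicate-1 : ∀ k → L (replicate k 1) ≡ []
L-replicate-1 zero    = refl
L-replicate-1 (suc k) = L-replicate-1 k

L-replicate-2+ : ∀ k x → L (replicate k (suc (suc x))) ≡ replicate k (suc x)
L-replicate-2+ zero    x = refl
L-replicate-2+ (suc k) x = cong (suc x ∷_) (L-replicate-2+ k x)

L∘T-nrrs : ∀ n r s → L (T (nrrs (suc (suc n)) (suc (suc r)) s)) ≡ nrrs (suc n) (suc r) s
L∘T-nrrs n r s =
  trans (L-++ (replicate (suc r) (suc (suc n))) (replicate s (suc (suc r))))
        (cong₂ _++_ (L-replicate-2+ (suc r) n) (L-replicate-2+ s r))

isP-if-L∘T-isP : ∀ {x y ys} → IsP (L (T (suc (suc x) ∷ y ∷ ys))) → IsP (suc (suc x) ∷ y ∷ ys)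
isP-if-L∘T-isP {x} {y} {ys} p = p-move _ _ (n-T (suc x) (L (y ∷ ys)) p) (n-L y ys p)

nrrs-isP : ∀ o k s → IsP (nrrs (suc (suc k + o)) (suc k) (suc s))
nrrs-isP o zero    s = isP-if-L∘T-isP (subst IsP (sym (L-replicate-1 (suc s))) p-empty)
nrrs-isP o (suc k) s = isP-if-L∘T-isP (subst IsP (sym (L∘T-nrrs (suc k + o) k (suc s))) (nrrs-isP o k s))

mex2-nonzero : ∀ {a b} → a ≢ 0 → b ≢ 0 → mex2 a b ≡ 0
mex2-nonzero {a} {b} a≢0 b≢0 with a ≟ 0 | b ≟ 0
... | yes a≡0 | _       = ⊥-elim (a≢0 a≡0)
... | no _    | yes b≡0 = ⊥-elim (b≢0 b≡0)
... | no _    | no _    = refl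

mex2≡0⇒ : ∀ a b → mex2 a b ≡ 0 → a ≢ 0 × b ≢ 0
mex2≡0⇒ a b eq with a ≟ 0 | b ≟ 0
... | no a≢0 | no b≢0 = a≢0 , b≢0
... | yes _ | _ with a ≟ 1 | b ≟ 1
...   | no _  | no _  = ⊥-elim (1+n≢0 eq)
...   | yes _ | _     = ⊥-elim (1+n≢0 eq)
...   | no _  | yes _ = ⊥-elim (1+n≢0 eq)
mex2≡0⇒ a b eq | no _ | yes _ with a ≟ 1 | b ≟ 1
...   | no _  | no _  = ⊥-elim (1+n≢0 eq)
...   | yes _ | _     = ⊥-elim (1+n≢0 eq)
...   | no _  | yes _ = ⊥-elim (1+n≢0 eq)

sum-L-≤ : ∀ xs → sum (L xs) ≤ sum xs
sum-L-≤ []                 = z≤n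
sum-L-≤ (zero ∷ xs)        = sum-L-≤ xs
sum-L-≤ (suc zero ∷ xs)    = ≤-trans (sum-L-≤ xs) (n≤1+n (sum xs))
sum-L-≤ (suc (suc x) ∷ xs) = +-mono-≤ (n≤1+n (suc x)) (sum-L-≤ xs)

sum-L-< : ∀ {x} xs → x ≢ 0 → sum (L (x ∷ xs)) < sum (x ∷ xs)
sum-L-< {zero}        xs x≢0 = ⊥-elim (x≢0 refl)
sum-L-< {suc zero}    xs _   = s≤s (sum-L-≤ xs)
sum-L-< {suc (suc x)} xs _   = s≤s (+-monoʳ-≤ (suc x) (sum-L-≤ xs))

sum-T-< : ∀ {x} xs → x ≢ 0 → sum xs < sum (x ∷ xs)
sum-T-< {zero}  xs x≢0 = ⊥-elim (x≢0 refl)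
sum-T-< {suc x} xs _   = s≤s (m≤n+m (sum xs) x)

All-L : ∀ xs → All (_≢ 0) (L xs)
All-L xs = all-filter (λ x → ¬? (x ≟ 0)) (map (_∸ 1) xs)

mutual
  isP⇒SG-fuel≡0 : ∀ {f xs} → All (_≢ 0) xs → sum xs < f → IsP xs → SG-fuel f xs ≡ 0
  isP⇒SG-fuel≡0 {suc f} _ _ p-empty = refl
  isP⇒SG-fuel≡0 {suc f} (x≢0 ∷ xs≢0) (s≤s sum<f) (p-move x xs nL nT) =
    mex2-nonzero (isN⇒SG-fuel≢0 (All-L (x ∷ xs)) (<-≤-trans (sum-L-< xs x≢0) sum<f) nL)
                 (isN⇒SG-fuel≢0 xs≢0 (<-≤-trans (sum-T-< xs x≢0) sum<f) nT)

  isN⇒SG-fuel≢0 : ∀ {f xs} → All (_≢ 0) xs → sum xs < f → IsN xs → SG-fuel f xs ≢ 0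
  isN⇒SG-fuel≢0 {suc f} (x≢0 ∷ _) (s≤s sum<f) (n-L x xs p) SG≡0 =
    proj₁ (mex2≡0⇒ (SG-fuel f (L (x ∷ xs))) (SG-fuel f xs) SG≡0)
          (isP⇒SG-fuel≡0 (All-L (x ∷ xs)) (<-≤-trans (sum-L-< xs x≢0) sum<f) p)
  isN⇒SG-fuel≢0 {suc f} (x≢0 ∷ xs≢0) (s≤s sum<f) (n-T x xs p) SG≡0 =
    proj₂ (mex2≡0⇒ (SG-fuel f (L (x ∷ xs))) (SG-fuel f xs) SG≡0)
          (isP⇒SG-fuel≡0 xs≢0 (<-≤-trans (sum-T-< xs x≢0) sum<f) p)

isP⇒SG≡0 : ∀ {xs} → All (_≢ 0) xs → IsP xs → SG xs ≡ 0
isP⇒SG≡0 xs≢0 = isP⇒SG-fuel≡0 xs≢0 ≤-refl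

All-nrrs : ∀ n r s → All (_≢ 0) (nrrs (suc n) (suc r) s)
All-nrrs n r s = ++⁺ (replicate⁺ (suc r) λ ()) (replicate⁺ s λ ())

lemma3p12 : (n r s : ℕ) → 0 < n → 0 < r → 0 < s → n > r →
    IsP (nrrs n r s) × SG (nrrs n r s) ≡ 0
lemma3p12 n (suc k) (suc s) _ _ _ n>r with m≤n⇒∃[o]m+o≡n n>r
... | o , refl = isP , isP⇒SG≡0 (All-nrrs (suc k + o) k (suc s)) isP
  where
  isP : IsP (nrrs (suc (suc k + o)) (suc k) (suc s))
  isP = nrrs-isP o k s
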